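{- Let $n,m,j\in\mathbb{Z}^+$ with $m\ge3$ and $1\le j<m/2$, and suppose $4\mid n$ and $2\nmid m$. Then a closed coloring of the generalized Petersen graph $G(m,j)$ with remainder $2\bmod n$ exists if and only if $8\nmid n$.
   Context: The generalized Petersen graph $G(m,j)$ has vertex set $\{v_i,u_i: i\in\mathbb{Z}_m\}$ and edge set $\{v_iv_{i+1}, v_iu_i, u_iu_{i+j}: i\in\mathbb{Z}_m\}$ (indices mod $m$). A closed coloring with remainder $k\bmod n$ of a graph $G=(V,E)$ is a map $\ell:V\to\mathbb{Z}$ with $\sum_{w\in N[v]}\ell(w)\equiv k\pmod n$ for every $v\in V$, where $N[v]$ is the closed neighborhood of $v$. -}

module Defs where

open import Data.Nat as ℕ using (ℕ; suc; NonZero)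
open import Data.Nat.DivMod using (_%_)
open import Data.Integer as ℤ using (ℤ; +_; _-_)
open import Data.Integer.Divisibility using (_∣_)

-- Vertices of G(m,j): v_i and u_i for i ∈ ℤ_m, encoded by natural indices
-- i < m (indices are always reduced mod m below).
data Vtx : Set where
  v : ℕ → Vtx
  u : ℕ → Vtx

module _ (m : ℕ) .{{_ : NonZero m}} where
  plus : ℕ → ℕ → ℕ
  plus i a = (i ℕ.+ a) % m

  minus : ℕ → ℕ → ℕ
  minus i a = (i ℕ.+ (m ℕ.∸ (a % m))) % m

-- N[v_i] = {v_i, v_{i-1}, v_{i+1}, u_i},  N[u_i] = {u_i, u_{i-j}, u_{i+j}, v_i}.
-- For m ≥ 3 and 1 ≤ j < m/2 these four vertices are pairwise distinct,
-- so the sum over N[x] is exactly the sum of these four labels.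
closedSum : (m j : ℕ) .{{_ : NonZero m}} → (Vtx → ℤ) → Vtx → ℤ
closedSum m j ℓ (v i) = ℓ (v i) ℤ.+ ℓ (v (minus m i 1)) ℤ.+ ℓ (v (plus m i 1)) ℤ.+ ℓ (u i)
closedSum m j ℓ (u i) = ℓ (u i) ℤ.+ ℓ (u (minus m i j)) ℤ.+ ℓ (u (plus m i j)) ℤ.+ ℓ (v i)

_≡_[mod_] : ℤ → ℤ → ℕ → Set
a ≡ b [mod n ] = (+ n) ∣ (a - b)

IsClosedColoring : (m j : ℕ) .{{_ : NonZero m}} → (n : ℕ) → (k : ℤ) → (Vtx → ℤ) → Set
IsClosedColoring m j n k ℓ =
  (i : ℕ) → i ℕ.< m →
    (closedSum m j ℓ (v i) ≡ k [mod n ]) ×' (closedSum m j ℓ (u i) ≡ k [mod n ])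
  where open import Data.Product using () renaming (_×_ to _×'_)

-- Summing the closed-neighbourhood congruences over all v_i gives 3A + B ≡ 2m (mod n),
-- and over all u_i gives 3B + A ≡ 2m, where A and B are the label sums of the outer and
-- inner cycles (each neighbour sum is a rotation of A or B). If 8 ∣ n, the combination
-- (3B + A) − 3(3A + B) + 8A = 4m is then divisible by 8, forcing m to be even.
-- Conversely, if n = 4 + 8h, labelling every v_i by 2 + 3h and every u_i by −h makes
-- the closed sums 2 + n and 2.
module Submission where

open import Defs
open import Data.Nat using (ℕ; _<_; _≤_; _*_; NonZero)
open import Data.Nat.Divisibility using (_∣_)
open import Data.Integer using (ℤ; +_)
open import Data.Product using (∃)
open import Relation.Nullary using (¬_)
open import Function.Bundles using (_⇔_)

open import Data.Nat as ℕ using (zero; suc; s≤s)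
import Data.Nat.Properties as ℕₚ
import Data.Nat.Divisibility as ℕ∣
open import Data.Nat.DivMod using (_%_; %-distribˡ-+; m%n%n≡m%n; m<n⇒m%n≡m; n%n≡0)
import Data.Nat.Tactic.RingSolver as ℕRing
open import Data.Integer as ℤ using (-_; _-_)
import Data.Integer.Properties as ℤₚ
open import Data.Integer.Divisibility.Signed as Signed using (∣ᵤ⇒∣; ∣⇒∣ᵤ)
open import Data.Integer.Tactic.RingSolver using (solve-∀)
open import Data.Product using (_,_; proj₁; proj₂)
open import Function using (_∘′_)
open import Function.Bundles using (mk⇔)
open import Relation.Nullary using (contradiction)
open import Relation.Binary.PropositionalEquality

∑ : ℕ → (ℕ → ℤ) → ℤ
∑ zero    f = + 0
∑ (suc m) f = ∑ m f ℤ.+ f m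

∑-cong : ∀ m {f g : ℕ → ℤ} → (∀ i → i < m → f i ≡ g i) → ∑ m f ≡ ∑ m g
∑-cong zero    f≡g = refl
∑-cong (suc m) f≡g = cong₂ ℤ._+_ (∑-cong m (λ i i<m → f≡g i (ℕₚ.m<n⇒m<1+n i<m))) (f≡g m ℕₚ.≤-refl)

∑-+ : ∀ m (f g : ℕ → ℤ) → ∑ m (λ i → f i ℤ.+ g i) ≡ ∑ m f ℤ.+ ∑ m g
∑-+ zero    f g = refl
∑-+ (suc m) f g = begin
  ∑ m (λ i → f i ℤ.+ g i) ℤ.+ (f m ℤ.+ g m) ≡⟨ cong (ℤ._+ (f m ℤ.+ g m)) (∑-+ m f g) ⟩
  ∑ m f ℤ.+ ∑ m g ℤ.+ (f m ℤ.+ g m)         ≡⟨ interchange (∑ m f) (∑ m g) (f m) (g m) ⟩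
  ∑ m f ℤ.+ f m ℤ.+ (∑ m g ℤ.+ g m)         ∎
  where
  open ≡-Reasoning
  interchange : ∀ a b c d → a ℤ.+ b ℤ.+ (c ℤ.+ d) ≡ a ℤ.+ c ℤ.+ (b ℤ.+ d)
  interchange = solve-∀

∑-const : ∀ m k → ∑ m (λ _ → + k) ≡ + (m ℕ.* k)
∑-const zero    k = refl
∑-const (suc m) k = trans (cong (ℤ._+ + k) (∑-const m k)) (cong +_ (ℕₚ.+-comm (m ℕ.* k) k))

∑-suc : ∀ m (f : ℕ → ℤ) → ∑ (suc m) f ≡ f 0 ℤ.+ ∑ m (λ i → f (suc i))
∑-suc zero    f = ℤₚ.+-comm (+ 0) (f 0)
∑-suc (suc m) f = trans (cong (ℤ._+ f (suc m)) (∑-suc m f)) (ℤₚ.+-assoc (f 0) _ _)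

plus-assoc : ∀ m .{{_ : NonZero m}} i a b → plus m (plus m i a) b ≡ plus m i (a ℕ.+ b)
plus-assoc m i a b = begin
  ((i ℕ.+ a) % m ℕ.+ b) % m            ≡⟨ %-distribˡ-+ ((i ℕ.+ a) % m) b m ⟩
  ((i ℕ.+ a) % m % m ℕ.+ b % m) % m    ≡⟨ cong (λ x → (x ℕ.+ b % m) % m) (m%n%n≡m%n (i ℕ.+ a) m) ⟩
  ((i ℕ.+ a) % m ℕ.+ b % m) % m        ≡⟨ %-distribˡ-+ (i ℕ.+ a) b m ⟨
  (i ℕ.+ a ℕ.+ b) % m                  ≡⟨ cong (_% m) (ℕₚ.+-assoc i a b) ⟩
  (i ℕ.+ (a ℕ.+ b)) % m                ∎
  where open ≡-Reasoning

plus-identityʳ : ∀ m .{{_ : NonZero m}} {i} → i < m → plus m i 0 ≡ i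
plus-identityʳ m {i} i<m = trans (cong (_% m) (ℕₚ.+-identityʳ i)) (m<n⇒m%n≡m i<m)

∑-rotate₁ : ∀ p (f : ℕ → ℤ) → ∑ (suc p) (λ i → f (plus (suc p) i 1)) ≡ ∑ (suc p) f
∑-rotate₁ p f = begin
  ∑ p (λ i → f (plus m i 1)) ℤ.+ f (plus m p 1) ≡⟨ cong₂ ℤ._+_ (∑-cong p (λ i i<p → cong f (wraps i<p))) (cong f last) ⟩
  ∑ p (λ i → f (suc i)) ℤ.+ f 0                 ≡⟨ ℤₚ.+-comm _ (f 0) ⟩
  f 0 ℤ.+ ∑ p (λ i → f (suc i))                 ≡⟨ ∑-suc p f ⟨
  ∑ m f                                         ∎
  where
  open ≡-Reasoning
  m = suc p
  wraps : ∀ {i} → i < p → plus m i 1 ≡ suc i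
  wraps {i} i<p = trans (cong (_% m) (ℕₚ.+-comm i 1)) (m<n⇒m%n≡m (s≤s i<p))
  last : plus m p 1 ≡ 0
  last = trans (cong (_% m) (ℕₚ.+-comm p 1)) (n%n≡0 m)

∑-rotate : ∀ m .{{_ : NonZero m}} a (f : ℕ → ℤ) → ∑ m (λ i → f (plus m i a)) ≡ ∑ m f
∑-rotate (suc p) zero    f = ∑-cong (suc p) (λ i i<m → cong f (plus-identityʳ (suc p) i<m))
∑-rotate (suc p) (suc a) f = begin
  ∑ m (λ i → f (plus m i (suc a)))          ≡⟨ ∑-cong m (λ i _ → cong f (plus-assoc m i 1 a)) ⟨
  ∑ m (λ i → f (plus m (plus m i 1) a))     ≡⟨ ∑-rotate₁ p (λ i → f (plus m i a)) ⟩
  ∑ m (λ i → f (plus m i a))                ≡⟨ ∑-rotate m a f ⟩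
  ∑ m f                                     ∎
  where
  open ≡-Reasoning
  m = suc p

-- minus m i a unfolds to plus m i (m ∸ a % m), so both neighbour sums are rotations.
∑-neighbourhood : ∀ m .{{_ : NonZero m}} a (x y : ℕ → ℤ) →
  ∑ m (λ i → x i ℤ.+ x (minus m i a) ℤ.+ x (plus m i a) ℤ.+ y i) ≡
  ∑ m x ℤ.+ ∑ m x ℤ.+ ∑ m x ℤ.+ ∑ m y
∑-neighbourhood m a x y = begin
  ∑ m (λ i → x i ℤ.+ x (minus m i a) ℤ.+ x (plus m i a) ℤ.+ y i)
    ≡⟨ ∑-+ m _ y ⟩
  ∑ m (λ i → x i ℤ.+ x (minus m i a) ℤ.+ x (plus m i a)) ℤ.+ ∑ m y
    ≡⟨ cong (ℤ._+ ∑ m y) (∑-+ m _ (λ i → x (plus m i a))) ⟩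
  ∑ m (λ i → x i ℤ.+ x (minus m i a)) ℤ.+ ∑ m (λ i → x (plus m i a)) ℤ.+ ∑ m y
    ≡⟨ cong (λ s → s ℤ.+ ∑ m (λ i → x (plus m i a)) ℤ.+ ∑ m y) (∑-+ m x _) ⟩
  ∑ m x ℤ.+ ∑ m (λ i → x (minus m i a)) ℤ.+ ∑ m (λ i → x (plus m i a)) ℤ.+ ∑ m y
    ≡⟨ cong₂ (λ s t → ∑ m x ℤ.+ s ℤ.+ t ℤ.+ ∑ m y) (∑-rotate m (m ℕ.∸ a % m) x) (∑-rotate m a x) ⟩
  ∑ m x ℤ.+ ∑ m x ℤ.+ ∑ m x ℤ.+ ∑ m y
    ∎
  where open ≡-Reasoning

≡[mod]⇒∣ : ∀ {n} a b → a ≡ b [mod n ] → + n Signed.∣ (a - b)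
≡[mod]⇒∣ {n} a b = ∣ᵤ⇒∣ {+ n} {a - b}

∣⇒≡[mod] : ∀ {n} a b → + n Signed.∣ (a - b) → a ≡ b [mod n ]
∣⇒≡[mod] {n} a b = ∣⇒∣ᵤ {+ n} {a - b}

≡[mod]-intro : ∀ {n} a b q → a - b ≡ q ℤ.* + n → a ≡ b [mod n ]
≡[mod]-intro a b q eq = ∣⇒≡[mod] a b (Signed.divides q eq)

≡[mod]-weaken : ∀ {d n} a b → d ∣ n → a ≡ b [mod n ] → a ≡ b [mod d ]
≡[mod]-weaken a b = ℕ∣.∣-trans

≡[mod]-+ : ∀ {n} a b c d → a ≡ b [mod n ] → c ≡ d [mod n ] → (a ℤ.+ c) ≡ (b ℤ.+ d) [mod n ]
≡[mod]-+ a b c d a≡b c≡d = ∣⇒≡[mod] (a ℤ.+ c) (b ℤ.+ d)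
  (subst (Signed._∣_ _) (regroup a b c d) (Signed.∣m∣n⇒∣m+n (≡[mod]⇒∣ a b a≡b) (≡[mod]⇒∣ c d c≡d)))
  where
  regroup : ∀ a b c d → (a - b) ℤ.+ (c - d) ≡ (a ℤ.+ c) - (b ℤ.+ d)
  regroup = solve-∀

∑-≡[mod] : ∀ m {n} (f g : ℕ → ℤ) → (∀ i → i < m → f i ≡ g i [mod n ]) → ∑ m f ≡ ∑ m g [mod n ]
∑-≡[mod] zero    f g f≡g = ℕ∣._∣0 _
∑-≡[mod] (suc m) f g f≡g =
  ≡[mod]-+ (∑ m f) (∑ m g) (f m) (g m) (∑-≡[mod] m f g (λ i i<m → f≡g i (ℕₚ.m<n⇒m<1+n i<m))) (f≡g m ℕₚ.≤-refl)

symmetric-system-≡[mod8] : ∀ {n} a b c → 8 ∣ n →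
  (a ℤ.+ a ℤ.+ a ℤ.+ b) ≡ c [mod n ] → (b ℤ.+ b ℤ.+ b ℤ.+ a) ≡ c [mod n ] → (c ℤ.+ c) ≡ + 0 [mod 8 ]
symmetric-system-≡[mod8] {n} a b c 8∣n 3a+b≡c 3b+a≡c = ∣⇒≡[mod] (c ℤ.+ c) (+ 0)
  (subst (Signed._∣_ _) (combination a b c)
    (Signed.∣m∣n⇒∣m+n (Signed.∣m∣n⇒∣m-n (mod8 (b ℤ.+ b ℤ.+ b ℤ.+ a) 3b+a≡c)
                                          (Signed.∣n⇒∣m*n (+ 3) (mod8 (a ℤ.+ a ℤ.+ a ℤ.+ b) 3a+b≡c)))
                      (Signed.∣n⇒∣m*n a Signed.∣-refl)))
  where
  mod8 : ∀ x → x ≡ c [mod n ] → + 8 Signed.∣ (x - c)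
  mod8 x x≡c = ≡[mod]⇒∣ x c (≡[mod]-weaken x c 8∣n x≡c)
  combination : ∀ a b c →
    (b ℤ.+ b ℤ.+ b ℤ.+ a - c) - + 3 ℤ.* (a ℤ.+ a ℤ.+ a ℤ.+ b - c) ℤ.+ a ℤ.* + 8 ≡ (c ℤ.+ c) - + 0
  combination = solve-∀

outerSum innerSum : ℕ → (Vtx → ℤ) → ℤ
outerSum m ℓ = ∑ m (λ i → ℓ (v i))
innerSum m ℓ = ∑ m (λ i → ℓ (u i))

module _ (m j : ℕ) .{{_ : NonZero m}} {n k} (ℓ : Vtx → ℤ) (closed : IsClosedColoring m j n (+ k) ℓ) where

  closedColoring⇒outer-≡[mod] :
    (outerSum m ℓ ℤ.+ outerSum m ℓ ℤ.+ outerSum m ℓ ℤ.+ innerSum m ℓ) ≡ + (m ℕ.* k) [mod n ]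
  closedColoring⇒outer-≡[mod] = subst₂ (_≡_[mod n ]) (∑-neighbourhood m 1 _ _) (∑-const m k)
    (∑-≡[mod] m (λ i → closedSum m j ℓ (v i)) (λ _ → + k) (λ i i<m → proj₁ (closed i i<m)))

  closedColoring⇒inner-≡[mod] :
    (innerSum m ℓ ℤ.+ innerSum m ℓ ℤ.+ innerSum m ℓ ℤ.+ outerSum m ℓ) ≡ + (m ℕ.* k) [mod n ]
  closedColoring⇒inner-≡[mod] = subst₂ (_≡_[mod n ]) (∑-neighbourhood m j _ _) (∑-const m k)
    (∑-≡[mod] m (λ i → closedSum m j ℓ (u i)) (λ _ → + k) (λ i i<m → proj₂ (closed i i<m)))

closedColoring⇒2∣m : ∀ m j .{{_ : NonZero m}} n (ℓ : Vtx → ℤ) → 8 ∣ n →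
  IsClosedColoring m j n (+ 2) ℓ → 2 ∣ m
closedColoring⇒2∣m m j n ℓ 8∣n closed = ℕ∣.*-cancelˡ-∣ 4 (subst (8 ∣_) (2c≡4m m) 8∣2c)
  where
  -- c ≡ + 0 [mod 8] unfolds to 8 ∣ ∣ c - + 0 ∣, which computes for c = + (m * 2) + + (m * 2).
  8∣2c : 8 ∣ m ℕ.* 2 ℕ.+ m ℕ.* 2 ℕ.+ 0
  8∣2c = symmetric-system-≡[mod8] (outerSum m ℓ) (innerSum m ℓ) (+ (m ℕ.* 2)) 8∣n
    (closedColoring⇒outer-≡[mod] m j ℓ closed) (closedColoring⇒inner-≡[mod] m j ℓ closed)
  2c≡4m : ∀ m → m ℕ.* 2 ℕ.+ m ℕ.* 2 ℕ.+ 0 ≡ 4 ℕ.* m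
  2c≡4m = ℕRing.solve-∀

uniform : ℤ → ℤ → Vtx → ℤ
uniform a b (v _) = a
uniform a b (u _) = b

uniform-isClosedColoring : ∀ m j .{{_ : NonZero m}} n k a b →
  (a ℤ.+ a ℤ.+ a ℤ.+ b) ≡ k [mod n ] → (b ℤ.+ b ℤ.+ b ℤ.+ a) ≡ k [mod n ] →
  IsClosedColoring m j n k (uniform a b)
uniform-isClosedColoring m j n k a b outer inner i _ = outer , inner

closedColoring-4+8h : ∀ m j .{{_ : NonZero m}} h →
  IsClosedColoring m j (4 ℕ.+ 8 ℕ.* h) (+ 2) (uniform (+ 2 ℤ.+ + 3 ℤ.* + h) (- + h))
closedColoring-4+8h m j h = uniform-isClosedColoring m j n (+ 2) a b
  (≡[mod]-intro (a ℤ.+ a ℤ.+ a ℤ.+ b) (+ 2) (+ 1) (trans (outer-excess (+ h)) (cong (ℤ._*_ (+ 1)) (sym n≡4+8h))))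
  (≡[mod]-intro (b ℤ.+ b ℤ.+ b ℤ.+ a) (+ 2) (+ 0) (inner-excess (+ h) (+ n)))
  where
  n = 4 ℕ.+ 8 ℕ.* h
  a b : ℤ
  a = + 2 ℤ.+ + 3 ℤ.* + h
  b = - + h
  n≡4+8h : + n ≡ + 4 ℤ.+ + 8 ℤ.* + h
  n≡4+8h = trans (ℤₚ.pos-+ 4 (8 ℕ.* h)) (cong (ℤ._+_ (+ 4)) (ℤₚ.pos-* 8 h))
  outer-excess : ∀ h → let a = + 2 ℤ.+ + 3 ℤ.* h in
    a ℤ.+ a ℤ.+ a ℤ.+ - h - + 2 ≡ + 1 ℤ.* (+ 4 ℤ.+ + 8 ℤ.* h)
  outer-excess = solve-∀
  inner-excess : ∀ h n → - h ℤ.+ - h ℤ.+ - h ℤ.+ (+ 2 ℤ.+ + 3 ℤ.* h) - + 2 ≡ + 0 ℤ.* n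
  inner-excess = solve-∀

4∣n∧8∤n⇒n≡4+8h : ∀ {n} → 4 ∣ n → ¬ 8 ∣ n → ∃ λ h → n ≡ 4 ℕ.+ 8 ℕ.* h
4∣n∧8∤n⇒n≡4+8h (ℕ∣.divides k refl) = odd-multiple k
  where
  odd-multiple : ∀ k → ¬ 8 ∣ k ℕ.* 4 → ∃ λ h → k ℕ.* 4 ≡ 4 ℕ.+ 8 ℕ.* h
  odd-multiple zero          8∤0 = contradiction (8 ℕ∣.∣0) 8∤0
  odd-multiple (suc zero)    _   = 0 , refl
  odd-multiple (suc (suc k)) 8∤n with odd-multiple k (8∤n ∘′ ℕ∣.∣m∣n⇒∣m+n ℕ∣.∣-refl)
  ... | h , eq = suc h , trans (cong (8 ℕ.+_) eq) (shift h)
    where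
    shift : ∀ h → 8 ℕ.+ (4 ℕ.+ 8 ℕ.* h) ≡ 4 ℕ.+ 8 ℕ.* suc h
    shift = ℕRing.solve-∀

lemma7p7 : (n m j : ℕ) .{{_ : NonZero m}} → 1 ≤ n → 3 ≤ m → 1 ≤ j → 2 * j < m →
    4 ∣ n → ¬ (2 ∣ m) →
    ((∃ λ (ℓ : Vtx → ℤ) → IsClosedColoring m j n (+ 2) ℓ) ⇔ (¬ (8 ∣ n)))
-- The size bounds only make the four vertices of each closed neighbourhood distinct,
-- which closedSum already presupposes; the argument does not use them.
lemma7p7 n m j _ _ _ _ 4∣n m-odd = mk⇔
  (λ (ℓ , closed) 8∣n → m-odd (closedColoring⇒2∣m m j n ℓ 8∣n closed))
  (λ 8∤n → let h , n≡4+8h = 4∣n∧8∤n⇒n≡4+8h 4∣n 8∤n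
               ℓ = uniform (+ 2 ℤ.+ + 3 ℤ.* + h) (- + h) in
    ℓ , subst (λ n → IsClosedColoring m j n (+ 2) ℓ) (sym n≡4+8h) (closedColoring-4+8h m j h))
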